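{- Let $G$ be a connected graph (no loops, no multiple edges), $b\in V_G$ and $\ell\in\mathbb{Z}_{\geq 0}$. Let $\operatorname{IP}_{G,b,\ell}$ be the set of indexed paths $\langle \mathbf{p},a\rangle$, where $\mathbf{p}$ is a $G$-path starting at $b$ with $\#\mathbf{p}>0$ and $a$ is an integer with $0\le a\le \ell+1-\#\mathbf{p}-n_{\mathbf{p}}$. Define $\langle\mathbf{p},a\rangle\preceq^{\mathrm{IP}}\langle\mathbf{q},c\rangle$ iff (i) $\mathbf{p}\preceq^{\mathrm{pre}}\mathbf{q}$ and (ii) $n_{\mathbf{p}}+a\ge d_{\mathbf{q}}(\#\mathbf{p})+c$; and define $\langle\mathbf{p},a\rangle\nleftrightarrow^{\mathrm{IP}}\langle\mathbf{q},c\rangle$ iff neither of $\mathbf{p},\mathbf{q}$ is a prefix of the other. Then $(\operatorname{IP}_{G,b,\ell},\preceq^{\mathrm{IP}},\nleftrightarrow^{\mathrm{IP}})$ is a PIP (poset with inconsistent pairs).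
   Context: A graph $H$ has vertex set $V_H$ and edge set $E_H\subseteq\{\{v,w\}: v\ne w\in V_H\}$. An $H$-path $\mathbf{p}$ consists of a length $\#\mathbf{p}\in\mathbb{Z}_{\ge0}$, edges $\mathbf{p}_1,\dots,\mathbf{p}_{\#\mathbf{p}}\in E_H$ and vertices $p_0,\dots,p_{\#\mathbf{p}}$ with $\mathbf{p}_i=\{p_{i-1},p_i\}$. If $p_{\#\mathbf{p}}=q_0$, the concatenation $\mathbf{p}\mathbf{q}$ traverses $\mathbf{p}$ then $\mathbf{q}$; $\mathbf{p}\preceq^{\mathrm{pre}}\mathbf{r}$ ($\mathbf{p}$ is a prefix of $\mathbf{r}$) if $\mathbf{r}=\mathbf{p}\mathbf{q}$ for some path $\mathbf{q}$. A path is cycle-free if its vertices $p_0,\dots,p_{\#\mathbf{p}}$ are distinct. For a path $\mathbf{p}$ with $\#\mathbf{p}>0$, its maximal-length cycle-free suffix decomposition is the unique integer $n_{\mathbf{p}}$ and paths $\mathbf{p}^{(1)},\dots,\mathbf{p}^{(n_{\mathbf{p}})}$ of positive length with $\mathbf{p}=\mathbf{p}^{(1)}\cdots\mathbf{p}^{(n_{\mathbf{p}})}$ such that, for each $t$, $\mathbf{p}^{(t)}$ is the longest cycle-free suffix of $\mathbf{p}^{(1)}\cdots\mathbf{p}^{(t)}$. For $r\in[1,\#\mathbf{p}]$, $d_{\mathbf{p}}(r)$ is the unique $t$ with $\#\mathbf{p}^{(1)}+\dots+\#\mathbf{p}^{(t-1)}+1\le r\le \#\mathbf{p}^{(1)}+\dots+\#\mathbf{p}^{(t)}$.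 A PIP is a poset $(\lambda,\preceq)$ with a symmetric relation $\nleftrightarrow$ such that $u\nleftrightarrow v\preceq w$ implies $u\nleftrightarrow w$. -}

module Defs where

open import Data.Nat using (ℕ; zero; suc; _+_; _∸_; _≤_; _<_; _≥_; _≤?_)
open import Data.Fin using (Fin) renaming (_≟_ to _≟ᶠ_)
open import Data.Bool using (Bool; true; false; T; if_then_else_)
open import Data.List using (List; []; _∷_; _++_; [_]; length; reverse; drop)
open import Data.Product using (_×_; ∃)
open import Data.Unit using (⊤)
open import Data.Empty using (⊥)
open import Relation.Nullary using (¬_; Dec; yes; no)
open import Relation.Binary.PropositionalEquality using (_≡_)
open import Relation.Binary.Structures using (IsPartialOrder)

record Graph : Set where
  field
    n          : ℕ
    adj        : Fin n → Fin n → Bool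
    adj-sym    : ∀ u v → adj u v ≡ adj v u
    adj-irrefl : ∀ v → adj v v ≡ false

open Graph public

Vtx : Graph → Set
Vtx G = Fin (n G)

-- A G-path starting at u is given (since G is simple) by its sequence of
-- vertices p_1 … p_k after p_0 = u, with consecutive vertices adjacent.
-- Its length #p is the length of that list.
IsPath : (G : Graph) → Vtx G → List (Vtx G) → Set
IsPath G u []       = ⊤
IsPath G u (v ∷ vs) = T (adj G u v) × IsPath G v vs

endVertex : {A : Set} → A → List A → A
endVertex u []       = u
endVertex u (v ∷ vs) = endVertex v vs

Connected : Graph → Set
Connected G = ∀ (u v : Vtx G) → ∃ λ vs → IsPath G u vs × endVertex u vs ≡ v

module _ {k : ℕ} where

  memb : Fin k → List (Fin k) → Bool
  memb x []       = false
  memb x (y ∷ ys) with x ≟ᶠ y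
  ... | yes _ = true
  ... | no  _ = memb x ys

  distinctPrefixLen : List (Fin k) → List (Fin k) → ℕ
  distinctPrefixLen seen []       = 0
  distinctPrefixLen seen (x ∷ xs) =
    if memb x seen then 0 else suc (distinctPrefixLen (x ∷ seen) xs)

  -- Given the REVERSED full vertex list  p_m ∷ … ∷ p_0  of a path, the longest
  -- cycle-free suffix has (distinctPrefixLen [] rs ∸ 1) edges.  The
  -- decomposition is: last block = longest cycle-free suffix of p, the earlier
  -- blocks = decomposition of the remaining prefix.  Returns the block
  -- lengths #p^(1), …, #p^(n_p) in order.  (Fuel = number of vertices, which
  -- suffices since every block has positive length.)
  blocksRev : ℕ → List (Fin k) → List ℕ
  blocksRev zero    rs = []
  blocksRev (suc f) rs with distinctPrefixLen [] rs ∸ 1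
  ... | zero  = []
  ... | suc e = blocksRev f (drop (suc e) rs) ++ [ suc e ]

blocks : (G : Graph) → Vtx G → List (Vtx G) → List ℕ
blocks G b vs = blocksRev (length (b ∷ vs)) (reverse (b ∷ vs))

nP : (G : Graph) → Vtx G → List (Vtx G) → ℕ
nP G b vs = length (blocks G b vs)

-- index t of the block containing edge r (1 ≤ r ≤ #p)
blockIndex : List ℕ → ℕ → ℕ
blockIndex []       r = 0
blockIndex (l ∷ ls) r with r ≤? l
... | yes _ = 1
... | no  _ = suc (blockIndex ls (r ∸ l))

dP : (G : Graph) → Vtx G → List (Vtx G) → ℕ → ℕ
dP G b vs r = blockIndex (blocks G b vs) r

record IP (G : Graph) (b : Vtx G) (ℓ : ℕ) : Set where
  constructor ip
  field
    path   : List (Vtx G)          -- vertices p_1 … p_{#p}; p_0 = b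
    isPath : IsPath G b path
    pos    : 0 < length path
    idx    : ℕ
    bound  : idx + length path + nP G b path ≤ ℓ + 1

open IP public

_≼pre_ : {A : Set} → List A → List A → Set
ps ≼pre qs = ∃ λ rs → qs ≡ ps ++ rs

module _ {G : Graph} {b : Vtx G} {ℓ : ℕ} where

  _≼IP_ : IP G b ℓ → IP G b ℓ → Set
  P ≼IP Q = (path P ≼pre path Q)
          × (nP G b (path P) + idx P ≥ dP G b (path Q) (length (path P)) + idx Q)

  _↮IP_ : IP G b ℓ → IP G b ℓ → Set
  P ↮IP Q = ¬ (path P ≼pre path Q) × ¬ (path Q ≼pre path P)

record IsPIP {A : Set} (_≼_ : A → A → Set) (_↮_ : A → A → Set) : Set where
  field
    isPartialOrder : IsPartialOrder _≡_ _≼_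
    ↮-sym          : ∀ {u v} → u ↮ v → v ↮ u
    ↮-≼            : ∀ {u v w} → u ↮ v → v ≼ w → u ↮ w

-- The decomposition is computed on the reversed vertex list, where the last block of a
-- walk is its longest repetition-free initial segment.  Everything except transitivity
-- of ≼IP is formal.  Transitivity reduces to the inequality
--   n_q − d_q(j) ≤ d_r(#q) − d_r(j)   for q a prefix of r and 1 ≤ j ≤ #q.
-- It holds because extending a walk can only move the start of its last block further
-- back (lastBlock-drop), so, counted from the end, the block boundaries of r lie at or
-- before those of q; an induction along the decomposition of r compares the block counts.

module Submission where

open import Defs
open import Data.Nat using (ℕ; zero; suc; _+_; _∸_; _≤_; _<_; _≤?_; z≤n; s≤s)
open import Data.Nat.Properties
open import Data.Nat.ListAction using (sum)
open import Data.Nat.ListAction.Properties using (sum-++)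
open import Data.Nat.Tactic.RingSolver using (solve-∀)
open import Data.Bool using (true; false; T)
open import Data.Bool.Properties using (T-irrelevant)
open import Data.Fin using (Fin) renaming (_≟_ to _≟ᶠ_)
open import Data.List using (List; []; _∷_; _++_; [_]; length; reverse; reverseAcc; drop)
open import Data.List.Properties
  using (length-++; length-drop; drop-drop; length-reverse; reverse-++; ++-assoc; ++-identityʳ;
         ++-identityʳ-unique; ++-conicalˡ; ∷-injective)
open import Data.List.Relation.Unary.Linked using (Linked; []; [-]; _∷_; tail)
open import Data.Product using (∃; _,_; proj₁)
open import Data.Sum using (_⊎_; inj₁; inj₂)
open import Data.Unit using (tt)
open import Data.Empty using (⊥-elim)
open import Relation.Nullary using (¬_; yes; no)
open import Relation.Binary.Core using (Rel)
open import Relation.Binary.Definitions using (Symmetric)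
open import Relation.Binary.PropositionalEquality hiding ([_])

+-≤-cancel-cross : ∀ {x y z u v w} → x + v ≤ y + w → w + u ≤ v + z → x + u ≤ y + z
+-≤-cancel-cross {x} {y} {z} {u} {v} {w} h₁ h₂ =
  +-cancelʳ-≤ (v + w) (x + u) (y + z)
    (subst₂ _≤_ (regroup x v w u) (trans (regroup y w v z) (cong (y + z +_) (+-comm w v))) (+-mono-≤ h₁ h₂))
  where
  regroup : ∀ a b c d → (a + b) + (c + d) ≡ (a + d) + (b + c)
  regroup = solve-∀

module _ {A : Set} where

  length-++-[] : ∀ (xs : List A) x → length (xs ++ [ x ]) ≡ suc (length xs)
  length-++-[] xs x = trans (length-++ xs) (+-comm (length xs) 1)

  drop-length-++ : ∀ (xs ys : List A) → drop (length xs) (xs ++ ys) ≡ ys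
  drop-length-++ []       ys = refl
  drop-length-++ (x ∷ xs) ys = drop-length-++ xs ys

  ≼pre-length : ∀ {xs ys : List A} → xs ≼pre ys → length xs ≤ length ys
  ≼pre-length {xs} (t , refl) = ≤-trans (m≤m+n (length xs) (length t)) (≤-reflexive (sym (length-++ xs)))

  ≼pre-refl : ∀ (xs : List A) → xs ≼pre xs
  ≼pre-refl xs = [] , sym (++-identityʳ xs)

  ≼pre-trans : ∀ {xs ys zs : List A} → xs ≼pre ys → ys ≼pre zs → xs ≼pre zs
  ≼pre-trans {xs} (s , refl) (t , refl) = s ++ t , ++-assoc xs s t

  ≼pre-antisym : ∀ {xs ys : List A} → xs ≼pre ys → ys ≼pre xs → xs ≡ ys
  ≼pre-antisym {xs} (s , refl) (t , xs≡xs++s++t) =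
    sym (trans (cong (xs ++_) (++-conicalˡ s t s++t≡[])) (++-identityʳ xs))
    where
    s++t≡[] : s ++ t ≡ []
    s++t≡[] = ++-identityʳ-unique xs (trans xs≡xs++s++t (++-assoc xs s t))

  ≼pre-common-extension : ∀ (xs ys : List A) {s t} → xs ++ s ≡ ys ++ t → xs ≼pre ys ⊎ ys ≼pre xs
  ≼pre-common-extension []       ys       _  = inj₁ (ys , refl)
  ≼pre-common-extension (x ∷ xs) []       _  = inj₂ (x ∷ xs , refl)
  ≼pre-common-extension (x ∷ xs) (y ∷ ys) eq with ∷-injective eq
  ... | refl , eq′ with ≼pre-common-extension xs ys eq′
  ...   | inj₁ (r , refl) = inj₁ (r , refl)
  ...   | inj₂ (r , refl) = inj₂ (r , refl)

  ≼pre-comparable : ∀ {xs ys zs : List A} → xs ≼pre zs → ys ≼pre zs → xs ≼pre ys ⊎ ys ≼pre xs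
  ≼pre-comparable {xs} {ys} (s , xs+s) (t , ys+t) = ≼pre-common-extension xs ys (trans (sym xs+s) ys+t)

  _≼suf_ : List A → List A → Set
  qs ≼suf rs = ∃ λ m → qs ≡ drop m rs

  edges : List A → ℕ
  edges rs = length rs ∸ 1

  edges-drop : ∀ m (rs : List A) → edges (drop m rs) ≡ edges rs ∸ m
  edges-drop m rs = begin
    length (drop m rs) ∸ 1  ≡⟨ cong (_∸ 1) (length-drop m rs) ⟩
    length rs ∸ m ∸ 1       ≡⟨ ∸-+-assoc (length rs) m 1 ⟩
    length rs ∸ (m + 1)     ≡⟨ cong (length rs ∸_) (+-comm m 1) ⟩
    length rs ∸ (1 + m)     ≡⟨ ∸-+-assoc (length rs) 1 m ⟨
    length rs ∸ 1 ∸ m       ∎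
    where open ≡-Reasoning

  ≼suf-edges : ∀ {qs rs : List A} → qs ≼suf rs → edges qs ≤ edges rs
  ≼suf-edges {rs = rs} (m , refl) = ≤-trans (≤-reflexive (edges-drop m rs)) (m∸n≤m (edges rs) m)

  Linked-drop : ∀ {r} {R : Rel A r} m {xs} → Linked R xs → Linked R (drop m xs)
  Linked-drop zero    l = l
  Linked-drop (suc m) [] = []
  Linked-drop (suc m) {_ ∷ _} l = Linked-drop m (tail l)

  Linked-reverse : ∀ {r} {R : Rel A r} → Symmetric R → ∀ {xs} → Linked R xs → Linked R (reverse xs)
  Linked-reverse         R-sym []         = []
  Linked-reverse {R = R} R-sym {_ ∷ xs} l = reverseAcc⁺ xs l [-]
    where
    reverseAcc⁺ : ∀ {x acc} xs → Linked R (x ∷ xs) → Linked R (x ∷ acc) → Linked R (reverseAcc (x ∷ acc) xs)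
    reverseAcc⁺ []       _         acc = acc
    reverseAcc⁺ (y ∷ ys) (xRy ∷ l) acc = reverseAcc⁺ ys l (R-sym xRy ∷ acc)

blockIndex-≤-length : ∀ ls r → blockIndex ls r ≤ length ls
blockIndex-≤-length []       r = z≤n
blockIndex-≤-length (l ∷ ls) r with r ≤? l
... | yes _ = s≤s z≤n
... | no  _ = s≤s (blockIndex-≤-length ls (r ∸ l))

blockIndex-++-inner : ∀ ls l r → 1 ≤ r → r ≤ sum ls → blockIndex (ls ++ [ l ]) r ≡ blockIndex ls r
blockIndex-++-inner []       l r 1≤r r≤0 = ⊥-elim (<⇒≱ 1≤r r≤0)
blockIndex-++-inner (m ∷ ms) l r 1≤r r≤ with r ≤? m
... | yes _   = refl
... | no  r≰m = cong suc (blockIndex-++-inner ms l (r ∸ m) (m<n⇒0<n∸m (≰⇒> r≰m)) (m≤n+o⇒m∸n≤o r m r≤))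

blockIndex-++-beyond : ∀ ls l r → sum ls < r → blockIndex (ls ++ [ l ]) r ≡ length (ls ++ [ l ])
blockIndex-++-beyond []       l r _ with r ≤? l
... | yes _ = refl
... | no  _ = refl
blockIndex-++-beyond (m ∷ ms) l r sum< with r ≤? m
... | yes r≤m = ⊥-elim (<⇒≱ sum< (≤-trans r≤m (m≤m+n m (sum ms))))
... | no  _   = cong suc (blockIndex-++-beyond ms l (r ∸ m) sum<r∸m)
  where
  sum<r∸m : sum ms < r ∸ m
  sum<r∸m = subst (_< r ∸ m) (m+n∸m≡n m (sum ms)) (∸-monoˡ-< sum< (m≤m+n m (sum ms)))

module _ {k : ℕ} where

  _⊆ᵐ_ : List (Fin k) → List (Fin k) → Set
  S ⊆ᵐ S′ = ∀ z → T (memb z S) → T (memb z S′)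

  ∷-⊆ᵐ : ∀ {S S′} x → S ⊆ᵐ S′ → (x ∷ S) ⊆ᵐ (x ∷ S′)
  ∷-⊆ᵐ {S} {S′} x S⊆S′ z z∈ with z ≟ᶠ x
  ... | yes _ = tt
  ... | no  _ = S⊆S′ z z∈

  distinctPrefixLen-≤-length : ∀ S (xs : List (Fin k)) → distinctPrefixLen S xs ≤ length xs
  distinctPrefixLen-≤-length S []       = z≤n
  distinctPrefixLen-≤-length S (x ∷ xs) with memb x S
  ... | true  = z≤n
  ... | false = s≤s (distinctPrefixLen-≤-length (x ∷ S) xs)

  distinctPrefixLen-antitone : ∀ {S S′} → S ⊆ᵐ S′ → ∀ xs → distinctPrefixLen S′ xs ≤ distinctPrefixLen S xs
  distinctPrefixLen-antitone S⊆S′ [] = z≤n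
  distinctPrefixLen-antitone {S} {S′} S⊆S′ (x ∷ xs) with memb x S′ in x∈S′
  ... | true  = z≤n
  ... | false with memb x S in x∈S
  ...   | true  = ⊥-elim (subst T x∈S′ (S⊆S′ x (subst T (sym x∈S) tt)))
  ...   | false = s≤s (distinctPrefixLen-antitone (∷-⊆ᵐ x S⊆S′) xs)

  lastBlock : List (Fin k) → ℕ
  lastBlock rs = distinctPrefixLen [] rs ∸ 1

  rest : List (Fin k) → List (Fin k)
  rest rs = drop (lastBlock rs) rs

  lastBlock-≤-edges : ∀ rs → lastBlock rs ≤ edges rs
  lastBlock-≤-edges rs = ∸-monoˡ-≤ 1 (distinctPrefixLen-≤-length [] rs)

  edges-rest+lastBlock : ∀ rs → edges (rest rs) + lastBlock rs ≡ edges rs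
  edges-rest+lastBlock rs = trans (cong (_+ lastBlock rs) (edges-drop (lastBlock rs) rs)) (m∸n+n≡m (lastBlock-≤-edges rs))

  lastBlock-∷ : ∀ x xs → lastBlock (x ∷ xs) ≤ suc (lastBlock xs)
  lastBlock-∷ x xs = ≤-trans (distinctPrefixLen-antitone (λ _ ()) xs) (m≤n+m∸n (distinctPrefixLen [] xs) 1)

  lastBlock-drop : ∀ m rs → lastBlock rs ≤ m + lastBlock (drop m rs)
  lastBlock-drop zero    rs       = ≤-refl
  lastBlock-drop (suc m) []       = z≤n
  lastBlock-drop (suc m) (x ∷ xs) = ≤-trans (lastBlock-∷ x xs) (s≤s (lastBlock-drop m xs))

  lastBlock-positive : ∀ {x y : Fin k} ys → x ≢ y → 1 ≤ lastBlock (x ∷ y ∷ ys)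
  lastBlock-positive {x} {y} ys x≢y with y ≟ᶠ x
  ... | yes y≡x = ⊥-elim (x≢y (sym y≡x))
  ... | no  _   = s≤s z≤n

  lastBlock≡0⇒edges≡0 : ∀ {rs} → Linked _≢_ rs → lastBlock rs ≡ 0 → edges rs ≡ 0
  lastBlock≡0⇒edges≡0 []                  _   = refl
  lastBlock≡0⇒edges≡0 [-]                 _   = refl
  lastBlock≡0⇒edges≡0 {_ ∷ _ ∷ ys} (x≢y ∷ _) lb≡0 =
    ⊥-elim (<⇒≱ (lastBlock-positive ys x≢y) (≤-reflexive lb≡0))

  rest-mono : ∀ {qs rs} → qs ≼suf rs → rest qs ≼suf rest rs
  rest-mono {rs = rs} (m , refl) = m + lastBlock (drop m rs) ∸ lastBlock rs , (begin
    drop (lastBlock (drop m rs)) (drop m rs)                            ≡⟨ drop-drop m _ rs ⟩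
    drop (m + lastBlock (drop m rs)) rs                                 ≡⟨ cong (λ i → drop i rs) m+lb≡ ⟨
    drop (lastBlock rs + (m + lastBlock (drop m rs) ∸ lastBlock rs)) rs ≡⟨ drop-drop (lastBlock rs) _ rs ⟨
    drop (m + lastBlock (drop m rs) ∸ lastBlock rs) (rest rs)           ∎)
    where
    open ≡-Reasoning
    m+lb≡ : lastBlock rs + (m + lastBlock (drop m rs) ∸ lastBlock rs) ≡ m + lastBlock (drop m rs)
    m+lb≡ = m+[n∸m]≡n (lastBlock-drop m rs)

  drop-≼suf-rest : ∀ {m} rs → lastBlock rs ≤ m → drop m rs ≼suf rest rs
  drop-≼suf-rest {m} rs lb≤m =
    m ∸ lastBlock rs , trans (cong (λ i → drop i rs) (sym (m+[n∸m]≡n lb≤m))) (sym (drop-drop (lastBlock rs) _ rs))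

  edges-rest<edges-drop : ∀ {m} rs → m < lastBlock rs → edges (rest rs) < edges (drop m rs)
  edges-rest<edges-drop {m} rs m<lb =
    subst₂ _<_ (sym (edges-drop (lastBlock rs) rs)) (sym (edges-drop m rs)) (∸-monoʳ-< m<lb (lastBlock-≤-edges rs))

  -- rs is a reversed vertex list; ls lists its block lengths in path order.
  data Decomposition : List (Fin k) → List ℕ → Set where
    trivial : ∀ {rs} → edges rs ≡ 0 → Decomposition rs []
    split   : ∀ {rs ls e} → lastBlock rs ≡ suc e → Decomposition (rest rs) ls → Decomposition rs (ls ++ [ suc e ])

  decomposition : ∀ f {rs} → Linked _≢_ rs → length rs ≤ f → Decomposition rs (blocksRev f rs)
  decomposition zero    {[]} _ _ = trivial refl
  decomposition (suc f) {rs} linked len with distinctPrefixLen [] rs ∸ 1 in lb≡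
  ... | zero  = trivial (lastBlock≡0⇒edges≡0 linked lb≡)
  ... | suc e = split lb≡ (subst (λ i → Decomposition (drop i rs) (blocksRev f (drop (suc e) rs))) (sym lb≡)
                  (decomposition f (Linked-drop (suc e) linked) length-rest≤f))
    where
    length-rest≤f : length (drop (suc e) rs) ≤ f
    length-rest≤f = ≤-trans (≤-reflexive (length-drop (suc e) rs)) (≤-trans (∸-monoˡ-≤ (suc e) len) (m∸n≤m f e))

  sum-decomposition : ∀ {rs ls} → Decomposition rs ls → sum ls ≡ edges rs
  sum-decomposition (trivial e) = sym e
  sum-decomposition {rs} (split {ls = ls} {e} lb≡ d) = begin
    sum (ls ++ [ suc e ])          ≡⟨ sum-++ ls [ suc e ] ⟩
    sum ls + (suc e + 0)           ≡⟨ cong₂ _+_ (sum-decomposition d) (trans (+-identityʳ (suc e)) (sym lb≡)) ⟩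
    edges (rest rs) + lastBlock rs ≡⟨ edges-rest+lastBlock rs ⟩
    edges rs                       ∎
    where open ≡-Reasoning

  blockIndex-inner : ∀ {rs ls} l {j} → Decomposition rs ls → 1 ≤ j → j ≤ edges rs →
                     blockIndex (ls ++ [ l ]) j ≡ blockIndex ls j
  blockIndex-inner {ls = ls} l {j} d 1≤j j≤ =
    blockIndex-++-inner ls l j 1≤j (subst (j ≤_) (sym (sum-decomposition d)) j≤)

  blockIndex-beyond : ∀ {rs ls} l {j} → Decomposition rs ls → edges rs < j →
                      blockIndex (ls ++ [ l ]) j ≡ length (ls ++ [ l ])
  blockIndex-beyond {ls = ls} l {j} d <j =
    blockIndex-++-beyond ls l j (subst (_< j) (sym (sum-decomposition d)) <j)

  blockIndex-edges : ∀ {rs ls} → Decomposition rs ls → 1 ≤ edges rs → blockIndex ls (edges rs) ≡ length ls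
  blockIndex-edges (trivial e)            1≤ = ⊥-elim (<⇒≱ 1≤ (≤-reflexive e))
  blockIndex-edges {rs} (split {e = e} lb≡ d) _ = blockIndex-beyond (suc e) d (begin-strict
    edges (rest rs)                ≤⟨ m≤m+n (edges (rest rs)) e ⟩
    edges (rest rs) + e            <⟨ ≤-reflexive (sym (+-suc (edges (rest rs)) e)) ⟩
    edges (rest rs) + suc e        ≡⟨ cong (edges (rest rs) +_) (sym lb≡) ⟩
    edges (rest rs) + lastBlock rs ≡⟨ edges-rest+lastBlock rs ⟩
    edges rs                       ∎)
    where open ≤-Reasoning

  -- In the additive forms below, length ls ∸ blockIndex ls j is the number of blocks after
  -- the one containing the j-th edge from b.
  laterBlocks-mono : ∀ {qs rs lq lr j} → qs ≼suf rs → Decomposition qs lq → Decomposition rs lr →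
                     1 ≤ j → j ≤ edges qs → length lq + blockIndex lr j ≤ length lr + blockIndex lq j
  laterBlocks-mono _ (trivial e) _ 1≤j j≤ = ⊥-elim (<⇒≱ 1≤j (≤-trans j≤ (≤-reflexive e)))
  laterBlocks-mono {qs} {rs} {lr = lr} {j} s (split {ls = lq} {e} _ dq) dr 1≤j j≤ with j ≤? edges (rest qs)
  ... | no j≰ = begin
    length (lq ++ [ suc e ]) + blockIndex lr j ≡⟨ +-comm (length (lq ++ [ suc e ])) _ ⟩
    blockIndex lr j + length (lq ++ [ suc e ]) ≤⟨ +-monoˡ-≤ _ (blockIndex-≤-length lr j) ⟩
    length lr + length (lq ++ [ suc e ])       ≡⟨ cong (length lr +_) (blockIndex-beyond (suc e) dq (≰⇒> j≰)) ⟨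
    length lr + blockIndex (lq ++ [ suc e ]) j ∎
    where open ≤-Reasoning
  ... | yes j≤′ with dr
  ...   | trivial e′ = ⊥-elim (<⇒≱ 1≤j (≤-trans j≤ (≤-trans (≼suf-edges s) (≤-reflexive e′))))
  ...   | split {ls = lr′} {e′} _ dr′ =
    subst₂ _≤_ (cong₂ _+_ (sym (length-++-[] lq (suc e))) (sym (blockIndex-inner (suc e′) dr′ 1≤j j≤″)))
               (cong₂ _+_ (sym (length-++-[] lr′ (suc e′))) (sym (blockIndex-inner (suc e) dq 1≤j j≤′)))
      (s≤s (laterBlocks-mono (rest-mono s) dq dr′ 1≤j j≤′))
    where
    j≤″ : j ≤ edges (rest rs)
    j≤″ = ≤-trans j≤′ (≼suf-edges (rest-mono s))

  laterBlocks-bound : ∀ {qs rs lq lr j} → qs ≼suf rs → Decomposition qs lq → Decomposition rs lr →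
                      1 ≤ j → j ≤ edges qs → blockIndex lr j + length lq ≤ blockIndex lq j + blockIndex lr (edges qs)
  laterBlocks-bound s _ (trivial e) 1≤j j≤ =
    ⊥-elim (<⇒≱ 1≤j (≤-trans j≤ (≤-trans (≼suf-edges s) (≤-reflexive e))))
  laterBlocks-bound {rs = rs} {lq} {j = j} (m , refl) dq (split {ls = lr} {e} lb≡ dr) 1≤j j≤
    with lastBlock rs ≤? m
  ... | yes lb≤m =
    subst₂ _≤_ (cong (_+ length lq) (sym (blockIndex-inner (suc e) dr 1≤j (≤-trans j≤ edges≤))))
               (cong (blockIndex lq j +_) (sym (blockIndex-inner (suc e) dr (≤-trans 1≤j j≤) edges≤)))
      (laterBlocks-bound (drop-≼suf-rest rs lb≤m) dq dr 1≤j j≤)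
    where
    edges≤ : edges (drop m rs) ≤ edges (rest rs)
    edges≤ = ≼suf-edges (drop-≼suf-rest rs lb≤m)
  -- Edge #q lies in the last block of r, so d_r(#q) = n_r.
  ... | no lb≰m
    rewrite blockIndex-beyond (suc e) dr (edges-rest<edges-drop rs (≰⇒> lb≰m))
    = subst₂ _≤_ (+-comm (length lq) _) (+-comm (length (lr ++ [ suc e ])) _)
        (laterBlocks-mono (m , refl) dq (split lb≡ dr) 1≤j j≤)

module _ (G : Graph) (b : Vtx G) where

  backwards : List (Vtx G) → List (Vtx G)
  backwards vs = reverse (b ∷ vs)

  edges-backwards : ∀ vs → edges (backwards vs) ≡ length vs
  edges-backwards vs = cong (_∸ 1) (length-reverse (b ∷ vs))

  backwards-≼suf : ∀ {xs ys} → xs ≼pre ys → backwards xs ≼suf backwards ys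
  backwards-≼suf {xs} (t , refl) = length (reverse t) , sym (begin
    drop (length (reverse t)) (reverse ((b ∷ xs) ++ t))      ≡⟨ cong (drop (length (reverse t))) (reverse-++ (b ∷ xs) t) ⟩
    drop (length (reverse t)) (reverse t ++ backwards xs)    ≡⟨ drop-length-++ (reverse t) (backwards xs) ⟩
    backwards xs                                             ∎)
    where open ≡-Reasoning

  IsPath⇒Linked : ∀ {u} vs → IsPath G u vs → Linked _≢_ (u ∷ vs)
  IsPath⇒Linked []       _          = [-]
  IsPath⇒Linked {u} (v ∷ ws) (u~v , p) = u≢v ∷ IsPath⇒Linked ws p
    where
    u≢v : u ≢ v
    u≢v refl = subst T (adj-irrefl G u) u~v

  decomposition-backwards : ∀ {vs} → IsPath G b vs → Decomposition (backwards vs) (blocks G b vs)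
  decomposition-backwards {vs} p =
    decomposition (length (b ∷ vs)) (Linked-reverse ≢-sym (IsPath⇒Linked vs p))
      (≤-reflexive (length-reverse (b ∷ vs)))

  dP-length≡nP : ∀ {vs} → IsPath G b vs → 0 < length vs → dP G b vs (length vs) ≡ nP G b vs
  dP-length≡nP {vs} p pos =
    subst (λ j → blockIndex (blocks G b vs) j ≡ nP G b vs) (edges-backwards vs)
      (blockIndex-edges (decomposition-backwards p) (subst (1 ≤_) (sym (edges-backwards vs)) pos))

  IsPath-irrelevant : ∀ {u} vs (p p′ : IsPath G u vs) → p ≡ p′
  IsPath-irrelevant []       _        _          = refl
  IsPath-irrelevant (v ∷ ws) (t , p) (t′ , p′) = cong₂ _,_ (T-irrelevant t t′) (IsPath-irrelevant ws p p′)

module _ {G : Graph} {b : Vtx G} {ℓ : ℕ} where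

  IP-≡ : ∀ {P Q : IP G b ℓ} → path P ≡ path Q → idx P ≡ idx Q → P ≡ Q
  IP-≡ {ip vs p pos a bd} {ip .vs p′ pos′ .a bd′} refl refl
    rewrite IsPath-irrelevant G b vs p p′ | ≤-irrelevant pos pos′ | ≤-irrelevant bd bd′ = refl

  ≼IP-reflexive : ∀ {P Q : IP G b ℓ} → P ≡ Q → P ≼IP Q
  ≼IP-reflexive {P} refl =
    ≼pre-refl (path P) , +-monoˡ-≤ (idx P) (blockIndex-≤-length (blocks G b (path P)) (length (path P)))

  ≼IP-same-path : ∀ {P Q : IP G b ℓ} → path P ≡ path Q → P ≼IP Q → idx Q ≤ idx P
  ≼IP-same-path {ip vs p pos a _} {ip .vs _ _ c _} refl (_ , c≤a) =
    +-cancelˡ-≤ (nP G b vs) c a (subst (λ d → d + c ≤ nP G b vs + a) (dP-length≡nP G b p pos) c≤a)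

  ≼IP-antisym : ∀ {P Q : IP G b ℓ} → P ≼IP Q → Q ≼IP P → P ≡ Q
  ≼IP-antisym {P} {Q} P≼Q Q≼P =
    IP-≡ path≡ (≤-antisym (≼IP-same-path {Q} {P} (sym path≡) Q≼P) (≼IP-same-path {P} {Q} path≡ P≼Q))
    where
    path≡ : path P ≡ path Q
    path≡ = ≼pre-antisym (proj₁ P≼Q) (proj₁ Q≼P)

  ≼IP-trans : ∀ {P Q R : IP G b ℓ} → P ≼IP Q → Q ≼IP R → P ≼IP R
  ≼IP-trans {P} {Q} {R} (P≼Q , h₁) (Q≼R , h₂) = ≼pre-trans P≼Q Q≼R ,
    ≤-trans (+-≤-cancel-cross {x = dP G b r (length p)} {y = dP G b q (length p)} {z = idx Q} {u = idx R}
                              {v = nP G b q} gap h₂) h₁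
    where
    p = path P
    q = path Q
    r = path R
    gap : dP G b r (length p) + nP G b q ≤ dP G b q (length p) + dP G b r (length q)
    gap = subst (λ j → dP G b r (length p) + nP G b q ≤ dP G b q (length p) + dP G b r j) (edges-backwards G b q)
            (laterBlocks-bound (backwards-≼suf G b Q≼R)
              (decomposition-backwards G b (isPath Q)) (decomposition-backwards G b (isPath R)) (pos P)
              (subst (length p ≤_) (sym (edges-backwards G b q)) (≼pre-length P≼Q)))

  ↮IP-sym : ∀ {P Q : IP G b ℓ} → P ↮IP Q → Q ↮IP P
  ↮IP-sym (P⋠Q , Q⋠P) = Q⋠P , P⋠Q

  ↮IP-≼ : ∀ {P Q R : IP G b ℓ} → P ↮IP Q → Q ≼IP R → P ↮IP R
  ↮IP-≼ (P⋠Q , Q⋠P) (Q≼R , _) = P⋠R , R⋠P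
    where
    P⋠R : ¬ _
    P⋠R P≼R with ≼pre-comparable P≼R Q≼R
    ... | inj₁ P≼Q = P⋠Q P≼Q
    ... | inj₂ Q≼P = Q⋠P Q≼P
    R⋠P : ¬ _
    R⋠P R≼P = Q⋠P (≼pre-trans Q≼R R≼P)

lemma3p2 : (G : Graph) → Connected G → (b : Vtx G) → (ℓ : ℕ) → IsPIP (_≼IP_ {G} {b} {ℓ}) (_↮IP_ {G} {b} {ℓ})
lemma3p2 G _ b ℓ = record
  { isPartialOrder = record
    { isPreorder = record
      { isEquivalence = isEquivalence
      ; reflexive     = λ {P} {Q} → ≼IP-reflexive {P = P} {Q}
      ; trans         = λ {P} {Q} {R} → ≼IP-trans {P = P} {Q} {R}
      }
    ; antisym = λ {P} {Q} → ≼IP-antisym {P = P} {Q}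
    }
  ; ↮-sym = λ {P} {Q} → ↮IP-sym {P = P} {Q}
  ; ↮-≼   = λ {P} {Q} {R} → ↮IP-≼ {P = P} {Q} {R}
  }
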